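{- Let $U$ be a Milliken-Taylor ultrafilter on $\mathrm{FIN}$ and let $I$ be the set of all $X\subseteq\mathrm{FIN}$ for which there is $N\in\omega$ such that $x\cap N\neq\emptyset$ for every $x\in X$. Then $I\subseteq U^*$ is an ideal and $U$ has the $I$-pseudo intersection property.
   Context: $\mathrm{FIN}=[\omega]^{<\omega}\setminus\{\emptyset\}$; $N\in\omega$ is identified with $\{0,\dots,N-1\}$. A block sequence is a sequence $\langle x_i\rangle$ in $\mathrm{FIN}$ with $\max(x_i)<\min(x_j)$ for $i<j$; $\mathrm{FIN}^{[\infty]}$ is the set of infinite block sequences. For $X=\langle x_i\rangle\in\mathrm{FIN}^{[\infty]}$, $[X]=\{\bigcup_{i\in F}x_i:F\in\mathrm{FIN}\}$; $X/m=\langle x_i:i\ge n\rangle$ with $n$ least such that $\min(x_n)>m$; $Y\le^*X$ iff $[Y/m]\subseteq[X]$ for some $m$. $U$ is Milliken-Taylor iff (1) every $A\in U$ contains some $[X]\in U$ with $X\in\mathrm{FIN}^{[\infty]}$, and (2) whenever $X_0\ge^*X_1\ge^*\cdots$ in $\mathrm{FIN}^{[\infty]}$ with all $[X_n]\in U$, there is $Y\in\mathrm{FIN}^{[\infty]}$ with $[Y]\in U$ and $X_n\ge^*Y$ for all $n$. $U^*=P(\mathrm{FIN})\setminus U$. For an ideal $I\subseteq U^*$, $U$ has the $I$-pseudo intersection property if for every $\langle A_n\rangle_{n<\omega}\subseteq U$ there is $A\in U$ with $A\setminus A_n\in I$ for all $n$. -}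

module Defs where

open import Level using (0ℓ)
open import Data.Nat using (ℕ; zero; suc; _+_; _<_; _<ᵇ_)
open import Data.Bool using (if_then_else_)
open import Data.List using (List; []; _∷_; concatMap; last)
open import Data.List.Relation.Unary.Any using (Any)
open import Data.Maybe using (Maybe; just; nothing)
open import Data.Product using (Σ; _×_; ∃; ∃-syntax)
open import Data.Sum using (_⊎_)
import Data.Unit
open import Relation.Binary.PropositionalEquality using (_≡_)
open import Relation.Nullary using (¬_)
open import Relation.Unary using (Pred; _⊆_; _∪_; _∩_; _∖_; ∁; ∅)

-- FIN: nonempty finite subsets of ℕ, encoded canonically (no proof
-- components) as (a , [g₁, …, gₖ]) denoting the set
-- {a, a+1+g₁, a+1+g₁+1+g₂, …}  (elements listed increasingly).
FIN : Set
FIN = Σ ℕ (λ _ → List ℕ)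

private
  go : ℕ → List ℕ → List ℕ
  go a []       = []
  go a (g ∷ gs) = suc (a + g) ∷ go (suc (a + g)) gs

toList : FIN → List ℕ
toList (a Data.Product., gs) = a ∷ go a gs

minF : FIN → ℕ
minF (a Data.Product., _) = a

maxF : FIN → ℕ
maxF (a Data.Product., gs) with last (go a gs)
... | just m  = m
... | nothing = a

_∈F_ : ℕ → FIN → Set
k ∈F x = Any (k ≡_) (toList x)

-- x ∩ N ≠ ∅  (N identified with {0,…,N-1})
meets : FIN → ℕ → Set
meets x N = Any (_< N) (toList x)

SubFIN : Set₁
SubFIN = Pred FIN 0ℓ

IsBlock : (ℕ → FIN) → Set
IsBlock X = ∀ i j → i < j → maxF (X i) < minF (X j)

BlockSeq : Set
BlockSeq = Σ (ℕ → FIN) IsBlock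

-- [X] = { ⋃_{i∈F} x_i : F ∈ FIN }.  Since F is listed increasingly and X
-- is a block sequence, the increasing enumeration of ⋃_{i∈F} x_i is the
-- concatenation of the enumerations of the x_i, i ∈ F.
⟦_⟧ : (ℕ → FIN) → SubFIN
⟦ X ⟧ z = ∃[ F ] (toList z ≡ concatMap (λ i → toList (X i)) (toList F))

-- least n with min(x_n) > m (searching n ≤ m+1; for a block sequence
-- min(x_n) ≥ n, so the search always succeeds)
private
  search : (ℕ → FIN) → ℕ → ℕ → ℕ → ℕ
  search X m i zero       = i
  search X m i (suc fuel) = if m <ᵇ minF (X i) then i else search X m (suc i) fuel

cutIndex : (ℕ → FIN) → ℕ → ℕ
cutIndex X m = search X m 0 (suc (suc m))

_/_ : (ℕ → FIN) → ℕ → (ℕ → FIN)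
(X / m) i = X (cutIndex X m + i)

_≤*_ : (ℕ → FIN) → (ℕ → FIN) → Set
Y ≤* X = ∃[ m ] (⟦ Y / m ⟧ ⊆ ⟦ X ⟧)

record IsUltrafilter (U : Pred SubFIN 0ℓ) : Set₁ where
  field
    full      : U (λ _ → Data.Unit.⊤)
    empty∉    : ¬ U ∅
    upward    : ∀ {A B} → U A → A ⊆ B → U B
    inter     : ∀ {A B} → U A → U B → U (A ∩ B)
    ultra     : ∀ A → U A ⊎ U (∁ A)

record IsMillikenTaylor (U : Pred SubFIN 0ℓ) : Set₁ where
  field
    ultrafilter : IsUltrafilter U
    cond1 : ∀ A → U A → ∃[ X ] (IsBlock X × ⟦ X ⟧ ⊆ A × U ⟦ X ⟧)
    cond2 : (Xs : ℕ → (ℕ → FIN)) → (∀ n → IsBlock (Xs n)) →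
            (∀ n → Xs (suc n) ≤* Xs n) → (∀ n → U ⟦ Xs n ⟧) →
            ∃[ Y ] (IsBlock Y × U ⟦ Y ⟧ × (∀ n → Y ≤* Xs n))

-- U* = P(FIN) ∖ U
Dual : Pred SubFIN 0ℓ → Pred SubFIN 0ℓ
Dual U A = ¬ U A

record IsIdeal (I : Pred SubFIN 0ℓ) : Set₁ where
  field
    has∅     : I ∅
    downward : ∀ {A B} → I B → A ⊆ B → I A
    union    : ∀ {A B} → I A → I B → I (A ∪ B)

Iset : Pred SubFIN 0ℓ
Iset X = ∃[ N ] (∀ x → X x → meets x N)

PseudoIntersectionProp : Pred SubFIN 0ℓ → Pred SubFIN 0ℓ → Set₁
PseudoIntersectionProp I U =
  (A : ℕ → SubFIN) → (∀ n → U (A n)) → ∃[ B ] (U B × (∀ n → I (B ∖ A n)))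

-- For a block sequence Y we have min(y_i) ≥ i, so no N meets every element
-- of [Y]; since every set in U contains such a span, I is disjoint from U.
-- For the pseudo intersection, refine the A_n into spans [X₀] ⊇ [X₁] ⊇ … in U
-- and take the diagonal [Y] ∈ U given by condition (2). When [Y/m] ⊆ [X_n],
-- an element of [Y] ∖ [X_n] must use one of the finitely many blocks of Y
-- below the cut, so it meets min of the first block after the cut.
module Submission where

open import Defs
open import Level using (0ℓ)
open import Data.Product using (_×_)
open import Relation.Unary using (Pred; _⊆_)

open import Data.Nat using (ℕ; zero; suc; _+_; _≤_; _<_; _⊔_; z≤n; s≤s; _<?_)
open import Data.Nat.Properties
open import Data.Empty using (⊥-elim)
open import Data.Sum using (inj₁; inj₂)
open import Data.List using (List; []; _∷_; last; map; drop; concatMap; _++_)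
open import Data.List.Properties using (++-identityʳ; concatMap-map)
open import Data.List.Relation.Unary.Any using (Any; here; there)
import Data.List.Relation.Unary.Any as Any
open import Data.List.Relation.Unary.All using (All; []; _∷_)
import Data.List.Relation.Unary.All as All
open import Data.Maybe using (just; nothing)
open import Data.Product using (_,_; proj₁; proj₂; ∃-syntax)
open import Relation.Binary.PropositionalEquality
open import Relation.Nullary using (¬_; yes; no)
open import Relation.Unary using (_∪_; _∩_; _∖_)
open import Function using (_∘_)

last-∈ : ∀ (xs : List ℕ) {m} → last xs ≡ just m → Any (m ≡_) xs
last-∈ (x ∷ [])     refl = here refl
last-∈ (x ∷ y ∷ ys) e    = there (last-∈ (y ∷ ys) e)

min<rest : ∀ a gs → All (a <_) (drop 1 (toList (a , gs)))
min<rest a []       = []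
min<rest a (g ∷ gs) =
  a<a+g+1 ∷ All.map (<-trans a<a+g+1) (min<rest (suc (a + g)) gs)
  where
  a<a+g+1 : a < suc (a + g)
  a<a+g+1 = s≤s (m≤m+n a g)

minF≤maxF : ∀ x → minF x ≤ maxF x
minF≤maxF (a , gs) with last (drop 1 (toList (a , gs))) in eq
... | just m  = <⇒≤ (All.lookup (min<rest a gs) (last-∈ _ eq))
... | nothing = ≤-refl

meets⇒minF< : ∀ x {N} → meets x N → minF x < N
meets⇒minF< (a , gs) (here a<N)  = a<N
meets⇒minF< (a , gs) (there k<N) = All.lookupWith <-trans (min<rest a gs) k<N

meets-mono : ∀ x {N M} → N ≤ M → meets x N → meets x M
meets-mono x N≤M = Any.map (λ k<N → <-≤-trans k<N N≤M)

block⇒i≤minF : ∀ X → IsBlock X → ∀ i → i ≤ minF (X i)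
block⇒i≤minF X b zero    = z≤n
block⇒i≤minF X b (suc i) =
  ≤-<-trans (≤-trans (block⇒i≤minF X b i) (minF≤maxF (X i))) (b i (suc i) ≤-refl)

toList-shift : ∀ c a gs → toList (c + a , gs) ≡ map (c +_) (toList (a , gs))
toList-shift c a []       = refl
toList-shift c a (g ∷ gs) = cong (c + a ∷_) (begin
  toList (suc (c + a + g) , gs)  ≡⟨ cong (λ s → toList (s , gs)) c+a+g+1≡c+[a+g+1] ⟩
  toList (c + suc (a + g) , gs)  ≡⟨ toList-shift c (suc (a + g)) gs ⟩
  map (c +_) (toList (suc (a + g) , gs)) ∎)
  where
  open ≡-Reasoning
  c+a+g+1≡c+[a+g+1] : suc (c + a + g) ≡ c + suc (a + g)
  c+a+g+1≡c+[a+g+1] = trans (cong suc (+-assoc c a g)) (sym (+-suc c (a + g)))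

_↓_ : (ℕ → FIN) → ℕ → (ℕ → FIN)
(X ↓ c) i = X (c + i)

span-index-shift : ∀ X c a gs →
  concatMap (λ i → toList (X i)) (toList (c + a , gs)) ≡
  concatMap (λ i → toList ((X ↓ c) i)) (toList (a , gs))
span-index-shift X c a gs =
  trans (cong (concatMap (λ i → toList (X i))) (toList-shift c a gs))
        (concatMap-map (λ i → toList (X i)) (c +_) (toList (a , gs)))

span-↓-⊆ : ∀ X c → ⟦ X ↓ c ⟧ ⊆ ⟦ X ⟧
span-↓-⊆ X c ((a , gs) , eq) =
  (c + a , gs) , trans eq (sym (span-index-shift X c a gs))

term∈span : ∀ X i → ⟦ X ⟧ (X i)
term∈span X i = (i , []) , sym (++-identityʳ _)

⊆⇒≤* : ∀ {X Y} → ⟦ Y ⟧ ⊆ ⟦ X ⟧ → Y ≤* X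
⊆⇒≤* {Y = Y} Y⊆X = 0 , λ p → Y⊆X (span-↓-⊆ Y (cutIndex Y 0) p)

minF-++ : ∀ {P : ℕ → Set} y rest → P (minF y) → Any P (toList y ++ rest)
minF-++ (a , gs) rest p = here p

-- An element of [Y] whose first index a lies below c begins with min(y_a) < min(y_c).
span-split : ∀ {Y} → IsBlock Y → ∀ c →
  ⟦ Y ⟧ ⊆ (λ z → meets z (minF (Y c))) ∪ ⟦ Y ↓ c ⟧
span-split {Y} b c ((a , gs) , eq) with a <? c
... | yes a<c = inj₁ (subst (Any (_< minF (Y c))) (sym eq)
                       (minF-++ (Y a) _ (≤-<-trans (minF≤maxF (Y a)) (b a c a<c))))
... | no a≮c with m≤n⇒∃[o]m+o≡n (≮⇒≥ a≮c)
...   | a' , refl = inj₂ ((a' , gs) , trans eq (span-index-shift Y c a' gs))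

≤*⇒span∖span∈I : ∀ {X Y} → IsBlock Y → Y ≤* X → Iset (⟦ Y ⟧ ∖ ⟦ X ⟧)
≤*⇒span∖span∈I {X} {Y} b (m , Y/m⊆X) = minF (Y (cutIndex Y m)) , below-cut
  where
  below-cut : ∀ z → (⟦ Y ⟧ ∖ ⟦ X ⟧) z → meets z (minF (Y (cutIndex Y m)))
  below-cut z (z∈Y , z∉X) with span-split b (cutIndex Y m) z∈Y
  ... | inj₁ meets-cut = meets-cut
  ... | inj₂ z∈Y/m     = ⊥-elim (z∉X (Y/m⊆X z∈Y/m))

Iset-isIdeal : IsIdeal Iset
Iset-isIdeal = record
  { has∅     = 0 , λ _ ()
  ; downward = λ { (N , meetsN) A⊆B → N , λ x x∈A → meetsN x (A⊆B x∈A) }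
  ; union    = λ { (N , meetsN) (M , meetsM) → N ⊔ M , λ
                   { x (inj₁ x∈A) → meets-mono x (m≤m⊔n N M) (meetsN x x∈A)
                   ; x (inj₂ x∈B) → meets-mono x (m≤n⊔m N M) (meetsM x x∈B) } }
  }

span∉Iset : ∀ {Y} → IsBlock Y → ¬ Iset ⟦ Y ⟧
span∉Iset {Y} b (N , meetsN) =
  <⇒≱ (meets⇒minF< (Y N) (meetsN (Y N) (term∈span Y N))) (block⇒i≤minF Y b N)

record BlockBase (U : Pred SubFIN 0ℓ) (A : SubFIN) : Set where
  field
    seq     : ℕ → FIN
    isBlock : IsBlock seq
    span⊆   : ⟦ seq ⟧ ⊆ A
    span∈   : U ⟦ seq ⟧

module MillikenTaylor {U : Pred SubFIN 0ℓ} (MT : IsMillikenTaylor U) where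
  open IsMillikenTaylor MT
  open IsUltrafilter ultrafilter
  open BlockBase

  blockBase : ∀ A → U A → BlockBase U A
  blockBase A A∈U with cond1 A A∈U
  ... | X , b , X⊆A , X∈U = record { seq = X ; isBlock = b ; span⊆ = X⊆A ; span∈ = X∈U }

  Iset⊆Dual : Iset ⊆ Dual U
  Iset⊆Dual A∈I A∈U = span∉Iset (isBlock base) (IsIdeal.downward Iset-isIdeal A∈I (span⊆ base))
    where base = blockBase _ A∈U

  module _ (A : ℕ → SubFIN) (A∈U : ∀ n → U (A n)) where
    nested : ∀ n → BlockBase U (A n)
    refine : ∀ n → BlockBase U (A (suc n) ∩ ⟦ seq (nested n) ⟧)

    nested zero    = blockBase (A 0) (A∈U 0)
    nested (suc n) = record
      { seq = seq (refine n) ; isBlock = isBlock (refine n)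
      ; span⊆ = proj₁ ∘ span⊆ (refine n) ; span∈ = span∈ (refine n) }

    refine n = blockBase _ (inter (A∈U (suc n)) (span∈ (nested n)))

    nested-⊆ : ∀ n → ⟦ seq (nested (suc n)) ⟧ ⊆ ⟦ seq (nested n) ⟧
    nested-⊆ n z∈Y = proj₂ (span⊆ (refine n) z∈Y)

    pseudoIntersection : ∃[ B ] (U B × (∀ n → Iset (B ∖ A n)))
    pseudoIntersection
      with cond2 (seq ∘ nested) (isBlock ∘ nested) (⊆⇒≤* ∘ nested-⊆) (span∈ ∘ nested)
    ... | Y , b , Y∈U , Y≤*nested = ⟦ Y ⟧ , Y∈U , λ n →
      IsIdeal.downward Iset-isIdeal (≤*⇒span∖span∈I b (Y≤*nested n))
        (λ (z∈Y , z∉A) → z∈Y , λ z∈X → z∉A (span⊆ (nested n) z∈X))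

proposition4p4 : (U : Pred SubFIN 0ℓ) → IsMillikenTaylor U →
    (IsIdeal Iset × (Iset ⊆ Dual U)) × PseudoIntersectionProp Iset U
proposition4p4 U MT = (Iset-isIdeal , Iset⊆Dual) , pseudoIntersection
  where open MillikenTaylor MT
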